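{- Consider the online graph embedding problem in a star host graph (defined in the context). The deterministic algorithm PivotTracking (described in the context) is $1.5$-competitive, i.e. for every finite request sequence $\sigma$, $\mathrm{ALG}(\sigma) \le 1.5\cdot \mathrm{OPT}(\sigma)$, where $\mathrm{ALG}(\sigma)$ is the cost of PivotTracking on $\sigma$ and $\mathrm{OPT}(\sigma)$ is the cost of an optimal offline algorithm on $\sigma$ starting from the same initial configuration.
   Context: Problem: The host graph is a star on $n$ physical hosts: one distinguished central host is at distance $1$ from every other host, and any two distinct non-central hosts are at distance $2$. A set $X$ of $n$ guest nodes is mapped bijectively to the hosts (a configuration); the guest node mapped to the central host is called the central node. An initial configuration is given. Requests arrive one at a time; each request $\sigma_t=\{x_1,x_2\}$ is a pair of distinct guest nodes, and must be served at a cost equal to the host distance between the hosts of $x_1$ and $x_2$ in the current configuration (so cost $1$ if one of them is the central node, $2$ otherwise). At any time (in particular after seeing a request and before serving it) an algorithm may migrate a guest node to the center, i.e. swap it with the current central node, at cost $1$. The cost of an algorithm on $\sigma$ is the total serving plus migration cost. An online algorithm decides without knowledge of future requests; an offline algorithm knows the whole sequence; both start in the same configuration. A deterministic online algorithm is $c$-competitive if $\mathrm{ALG}(\sigma)\le c\cdot\mathrm{OPT}(\sigma)$ for every request sequence $\sigma$. Algorithm PivotTracking (deterministic): Maintain a candidate set $\mathcal{C}$, initially $\{x_{\mathrm{init}}\}$ where $x_{\mathrm{init}}$ is the initial central node. When request $\sigma_t=\{x_1,x_2\}$ is issued: if $\mathcal{C}\cap\sigma_t\neq\emptyset$ (intersection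 behavior), set $\mathcal{C}\gets\mathcal{C}\cap\sigma_t$, and if no node of $\mathcal{C}$ is currently the central node, migrate a node of $\mathcal{C}$ to the center, breaking ties according to a fixed order; otherwise (union behavior) set $\mathcal{C}\gets\mathcal{C}\cup\sigma_t$ and do not migrate. Then serve $\sigma_t$. -}

module Defs where

open import Data.Nat using (ℕ; zero; suc; _+_; _*_; _<ᵇ_)
open import Data.Bool using (Bool; true; false; if_then_else_; _∧_; _∨_; not)
open import Data.Fin using (Fin)
open import Data.Fin.Properties using (_≟_)
open import Data.List using (List; []; _∷_; length)
open import Data.List.Relation.Unary.All using (All; []; _∷_)
open import Data.Vec using (Vec; lookup; updateAt)
open import Data.Product using (_×_; _,_; proj₁; proj₂)
open import Relation.Binary.PropositionalEquality using (_≢_)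
open import Relation.Nullary.Decidable using (⌊_⌋)
open import Data.Fin.Subset using (Subset; ⁅_⁆; _∩_; _∪_)

-- Guest nodes are Fin n (n = number of hosts = number of guests).
-- A request is a pair of distinct guest nodes.
record Request (n : ℕ) : Set where
  constructor req
  field
    x₁ : Fin n
    x₂ : Fin n
    distinct : x₁ ≢ x₂
open Request public

-- In a star, the host distance between the hosts of x₁ and x₂ depends only on
-- which guest node is central: 1 if one of them is central, 2 otherwise.
-- So the relevant part of a configuration is the central node c.
isEq : ∀ {n} → Fin n → Fin n → Bool
isEq a b = ⌊ a ≟ b ⌋

serveCost : ∀ {n} → Fin n → Request n → ℕ
serveCost c r = if isEq c (x₁ r) ∨ isEq c (x₂ r) then 1 else 2

-- Offline algorithms: before serving each request, perform an arbitrary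
-- finite list of migrations (each migrates the listed node to the center,
-- i.e. swaps it with the current central node, at cost 1), then serve.

migrateAll : ∀ {n} → Fin n → List (Fin n) → Fin n
migrateAll c []       = c
migrateAll c (x ∷ xs) = migrateAll x xs

OfflineSchedule : ∀ {n} → List (Request n) → Set
OfflineSchedule {n} σ = All (λ _ → List (Fin n)) σ

offlineCost : ∀ {n} → Fin n → (σ : List (Request n)) → OfflineSchedule σ → ℕ
offlineCost c []      []         = 0
offlineCost c (r ∷ σ) (ms ∷ sch) =
  let c' = migrateAll c ms in
  length ms + serveCost c' r + offlineCost c' σ sch

-- The fixed tie-breaking order is given by an injective rank function:
-- among tied candidates the one with smaller rank is migrated.

reqSet : ∀ {n} → Request n → Subset n
reqSet r = ⁅ x₁ r ⁆ ∪ ⁅ x₂ r ⁆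

ptStep : ∀ {n} → (Fin n → ℕ) → Fin n → Subset n → Request n
       → Fin n × Subset n × ℕ
ptStep rank c C r =
  let a   = x₁ r
      b   = x₂ r
      ina = lookup C a
      inb = lookup C b
  in if ina ∨ inb
     then (let C' = C ∩ reqSet r
               centralInC' = (isEq c a ∧ ina) ∨ (isEq c b ∧ inb)
           in if centralInC'
              then (c , C' , serveCost c r)
              else (let t = if ina ∧ inb
                              then (if rank b <ᵇ rank a then b else a)
                              else (if ina then a else b)
                    in (t , C' , 1 + serveCost t r)))
     else (c , C ∪ reqSet r , serveCost c r)

ptRun : ∀ {n} → (Fin n → ℕ) → Fin n → Subset n → List (Request n) → ℕ
ptRun rank c C []      = 0
ptRun rank c C (r ∷ σ) with ptStep rank c C r
... | (c' , C' , k) = k + ptRun rank c' C' σ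

ALG : ∀ {n} → (Fin n → ℕ) → Fin n → List (Request n) → ℕ
ALG rank xinit σ = ptRun rank xinit ⁅ xinit ⁆ σ

{-# OPTIONS --safe #-}
-- PivotTracking is analysed with a potential Φ that depends on the shape of the candidate set 𝒞
-- (a single node, at most two nodes, or unconstrained) and on whether the offline algorithm's
-- central node lies in 𝒞.  PivotTracking always pays what its current centre would pay without
-- migrating, and its centre stays in 𝒞.  Serving one request, together with the resulting updates
-- of 𝒞 and of both centres, increases 2·ALG + Φ by at most 3·OPT: this local inequality depends
-- only on a handful of Boolean facts about the request and is checked exhaustively.  Summing over
-- σ from the initial state, where Φ = 0, gives 2·ALG ≤ 3·OPT.
module Submission where

open import Defs
open import Data.Nat using (ℕ; _*_; _≤_)
open import Data.Fin using (Fin)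
open import Data.List using (List)
open import Relation.Binary.PropositionalEquality using (_≡_)
open import Function.Definitions using (Injective)

open import Data.Nat using (suc; _+_; _<ᵇ_; _≤?_; z≤n; s≤s)
open import Data.Nat.Properties using (+-monoˡ-≤; +-monoʳ-≤; *-monoʳ-≤; *-distribˡ-+; +-identityʳ; module ≤-Reasoning)
open import Data.Nat.Tactic.RingSolver using (solve-∀)
open import Data.Bool using (Bool; true; false; T; _∧_; _∨_; if_then_else_)
open import Data.Bool.Properties using (T?; T-≡; T-∨) renaming (_≟_ to _≟ᵇ_)
open import Data.Fin using (zero; suc)
open import Data.Fin.Properties using (_≟_)
open import Data.Fin.Subset using (Subset; _∈_; _∉_; _⊆_; ⁅_⁆; _∩_; _∪_)
open import Data.Fin.Subset.Properties using (x∈⁅x⁆; x∈⁅y⁆⇒x≡y; x∈⁅y⁆⇔x≡y; x∈p∩q⁺; x∈p∪q⁺; x∈p∪q⁻; p∩q⊆p; p∩q⊆q)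
open import Data.Vec using (lookup)
open import Data.Vec.Properties using (lookup-zipWith; lookup-replicate; []=⇒lookup; lookup⇒[]=)
open import Data.List using ([]; _∷_; length)
open import Data.List.Relation.Unary.All using ([]; _∷_)
open import Data.Product using (_×_; _,_; ∃; ∃₂)
open import Data.Sum using (_⊎_; inj₁; inj₂)
import Data.Sum as Sum
open import Data.Unit using (⊤; tt)
open import Function using (id; _∘_)
open import Function.Bundles using (Equivalence)
open import Relation.Binary.PropositionalEquality using (_≢_; refl; sym; trans; cong; cong₂; subst)
open import Relation.Nullary using (Dec; yes; no; contradiction)
open import Relation.Nullary.Decidable using (map′; _×-dec_; _→-dec_; toWitness; fromWitness)

private
  variable
    n : ℕ
    a b c d e x y z : Fin n
    C D : Subset n

T⇒∈ : T (lookup C x) → x ∈ C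
T⇒∈ {C = C} {x = x} h = lookup⇒[]= x C (Equivalence.to T-≡ h)

lookup≡false⇒∉ : lookup C x ≡ false → x ∉ C
lookup≡false⇒∉ eq x∈C = contradiction (trans (sym ([]=⇒lookup x∈C)) eq) λ ()

x∈⁅y⁆∪⁅z⁆⁺ : x ≡ y ⊎ x ≡ z → x ∈ ⁅ y ⁆ ∪ ⁅ z ⁆
x∈⁅y⁆∪⁅z⁆⁺ = x∈p∪q⁺ ∘ Sum.map (Equivalence.from x∈⁅y⁆⇔x≡y) (Equivalence.from x∈⁅y⁆⇔x≡y)

x∈⁅y⁆∪⁅z⁆⁻ : x ∈ ⁅ y ⁆ ∪ ⁅ z ⁆ → x ≡ y ⊎ x ≡ z
x∈⁅y⁆∪⁅z⁆⁻ h = Sum.map (x∈⁅y⁆⇒x≡y _) (x∈⁅y⁆⇒x≡y _) (x∈p∪q⁻ _ _ h)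

lookup-⁅⁆ : ∀ (y x : Fin n) → lookup ⁅ y ⁆ x ≡ isEq x y
lookup-⁅⁆ zero    zero    = refl
lookup-⁅⁆ zero    (suc x) = lookup-replicate x false
lookup-⁅⁆ (suc y) zero    = refl
lookup-⁅⁆ (suc y) (suc x) with x ≟ y | lookup-⁅⁆ y x
... | yes _ | ih = ih
... | no _  | ih = ih

lookup-reqSet : ∀ (r : Request n) x → lookup (reqSet r) x ≡ isEq x (x₁ r) ∨ isEq x (x₂ r)
lookup-reqSet r x = trans (lookup-zipWith _∨_ x ⁅ x₁ r ⁆ ⁅ x₂ r ⁆)
                          (cong₂ _∨_ (lookup-⁅⁆ (x₁ r) x) (lookup-⁅⁆ (x₂ r) x))

third-in-pair : a ≢ b → a ∈ ⁅ d ⁆ ∪ ⁅ e ⁆ → b ∈ ⁅ d ⁆ ∪ ⁅ e ⁆ → c ∈ ⁅ d ⁆ ∪ ⁅ e ⁆ → c ≡ a ⊎ c ≡ b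
third-in-pair a≢b a∈ b∈ c∈ with x∈⁅y⁆∪⁅z⁆⁻ a∈ | x∈⁅y⁆∪⁅z⁆⁻ b∈ | x∈⁅y⁆∪⁅z⁆⁻ c∈
... | inj₁ refl | inj₁ refl | _         = contradiction refl a≢b
... | inj₂ refl | inj₂ refl | _         = contradiction refl a≢b
... | inj₁ refl | inj₂ refl | c≡a       = c≡a
... | inj₂ refl | inj₁ refl | c≡b       = Sum.swap c≡b

distance : Bool → ℕ
distance b = if b then 1 else 2

nextCandidates : Subset n → Request n → Subset n
nextCandidates C r = if lookup C (x₁ r) ∨ lookup C (x₂ r) then C ∩ reqSet r else C ∪ reqSet r

data Shape : Set where
  singleton pair arbitrary : Shape

Confined : Shape → Fin n → Subset n → Set
Confined singleton c C = C ⊆ ⁅ c ⁆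
Confined pair      c C = ∃₂ λ d e → C ⊆ ⁅ d ⁆ ∪ ⁅ e ⁆
Confined arbitrary c C = ⊤

Invariant : Shape → Fin n → Subset n → Set
Invariant s c C = c ∈ C × Confined s c C

nextShape : Bool → Bool → Shape
nextShape true  true  = pair
nextShape false false = arbitrary
nextShape _     _     = singleton

shapeAfter : Subset n → Request n → Shape
shapeAfter C r = nextShape (lookup C (x₁ r)) (lookup C (x₂ r))

Φ : Shape → Bool → ℕ
Φ singleton true  = 0
Φ singleton false = 3
Φ pair      true  = 1
Φ pair      false = 4
Φ arbitrary true  = 2
Φ arbitrary false = 4

Pinned : Shape → (A B ca cb : Bool) → Set
Pinned singleton A B ca cb = (T A → T ca) × (T B → T cb)
Pinned pair      A B ca cb = T A → T B → T (ca ∨ cb)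
Pinned arbitrary A B ca cb = ⊤

Pinned? : ∀ s A B ca cb → Dec (Pinned s A B ca cb)
Pinned? singleton A B ca cb = (T? A →-dec T? ca) ×-dec (T? B →-dec T? cb)
Pinned? pair      A B ca cb = T? A →-dec T? B →-dec T? (ca ∨ cb)
Pinned? arbitrary A B ca cb = yes tt

∀-Bool? : {P : Bool → Set} → (∀ b → Dec (P b)) → Dec (∀ b → P b)
∀-Bool? P? = map′ (λ (t , f) → λ { true → t ; false → f }) (λ h → h true , h false)
                  (P? true ×-dec P? false)

∀-Shape? : {P : Shape → Set} → (∀ s → Dec (P s)) → Dec (∀ s → P s)
∀-Shape? P? = map′ (λ (p , q , u) → λ { singleton → p ; pair → q ; arbitrary → u })
                   (λ h → h singleton , h pair , h arbitrary)
                   (P? singleton ×-dec P? pair ×-dec P? arbitrary)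

updated : (A B O hit : Bool) → Bool
updated A B O hit = if A ∨ B then O ∧ hit else O ∨ hit

-- For a request {x₁, x₂}: A, B say whether x₁, x₂ are candidates and ca, cb whether they are
-- PivotTracking's centre; pa, pb whether they are the offline centre o′ after its migrations,
-- stay whether o′ is the previous offline centre o, and O, O′ whether o, o′ are candidates.
potential-step : ∀ s A B ca cb pa pb stay O O′ →
  (T pa → O′ ≡ A) → (T pb → O′ ≡ B) → (T stay → O′ ≡ O) → Pinned s A B ca cb →
  2 * distance (ca ∨ cb) + Φ (nextShape A B) (updated A B O′ (pa ∨ pb))
    ≤ 3 * ((if stay then 0 else 1) + distance (pa ∨ pb)) + Φ s O
potential-step = toWitness {a? =
  ∀-Shape? λ s → ∀-Bool? λ A → ∀-Bool? λ B → ∀-Bool? λ ca → ∀-Bool? λ cb →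
  ∀-Bool? λ pa → ∀-Bool? λ pb → ∀-Bool? λ stay → ∀-Bool? λ O → ∀-Bool? λ O′ →
  (T? pa →-dec O′ ≟ᵇ A) →-dec (T? pb →-dec O′ ≟ᵇ B) →-dec (T? stay →-dec O′ ≟ᵇ O) →-dec
  Pinned? s A B ca cb →-dec _ ≤? _} tt

invariant-pinned : ∀ s (r : Request n) → Invariant s c C →
  Pinned s (lookup C (x₁ r)) (lookup C (x₂ r)) (isEq c (x₁ r)) (isEq c (x₂ r))
invariant-pinned {c = c} {C = C} singleton r (_ , C⊆⁅c⁆) = centre ∘ T⇒∈ , centre ∘ T⇒∈
  where
  centre : ∀ {x} → x ∈ C → T (isEq c x)
  centre x∈C = fromWitness (sym (x∈⁅y⁆⇒x≡y _ (C⊆⁅c⁆ x∈C)))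
invariant-pinned {c = c} pair r (c∈C , _ , _ , C⊆de) A B =
  Equivalence.from T-∨ (Sum.map (fromWitness {a? = c ≟ x₁ r}) (fromWitness {a? = c ≟ x₂ r})
    (third-in-pair (distinct r) (C⊆de (T⇒∈ A)) (C⊆de (T⇒∈ B)) (C⊆de c∈C)))
invariant-pinned arbitrary r _ = tt

lookup-nextCandidates : ∀ (C : Subset n) r x → lookup (nextCandidates C r) x
  ≡ updated (lookup C (x₁ r)) (lookup C (x₂ r)) (lookup C x) (isEq x (x₁ r) ∨ isEq x (x₂ r))
lookup-nextCandidates C r x with lookup C (x₁ r) ∨ lookup C (x₂ r)
... | true  = trans (lookup-zipWith _∧_ x C (reqSet r)) (cong (lookup C x ∧_) (lookup-reqSet r x))
... | false = trans (lookup-zipWith _∨_ x C (reqSet r)) (cong (lookup C x ∨_) (lookup-reqSet r x))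

only-candidate : x ∈ C → b ∉ C → x ≡ a ⊎ x ≡ b → x ≡ a
only-candidate x∈C b∉C (inj₁ x≡a) = x≡a
only-candidate x∈C b∉C (inj₂ refl) = contradiction x∈C b∉C

constant⇒⊆⁅⁆ : (∀ {x} → x ∈ D → x ≡ a) → y ∈ D → D ⊆ ⁅ y ⁆
constant⇒⊆⁅⁆ only y∈D x∈D = Equivalence.from x∈⁅y⁆⇔x≡y (trans (only x∈D) (sym (only y∈D)))

nextCandidates-confined : ∀ (C : Subset n) r {y} → y ∈ nextCandidates C r →
  Confined (shapeAfter C r) y (nextCandidates C r)
nextCandidates-confined C r y∈ with lookup C (x₁ r) in A | lookup C (x₂ r) in B
... | true  | true  = x₁ r , x₂ r , p∩q⊆q C (reqSet r)
... | true  | false = constant⇒⊆⁅⁆ (λ x∈ →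
  only-candidate (p∩q⊆p C _ x∈) (lookup≡false⇒∉ B) (x∈⁅y⁆∪⁅z⁆⁻ (p∩q⊆q C _ x∈))) y∈
... | false | true  = constant⇒⊆⁅⁆ (λ x∈ →
  only-candidate (p∩q⊆p C _ x∈) (lookup≡false⇒∉ A) (Sum.swap (x∈⁅y⁆∪⁅z⁆⁻ (p∩q⊆q C _ x∈)))) y∈
... | false | false = tt

distance-T : ∀ {b} → T b → distance b ≡ 1
distance-T {true} _ = refl

serveCost-endpoint : ∀ (r : Request n) → x ≡ x₁ r ⊎ x ≡ x₂ r → serveCost x r ≡ 1
serveCost-endpoint {x = x} r x∈r =
  distance-T (Equivalence.from T-∨ (Sum.map (fromWitness {a? = x ≟ x₁ r}) (fromWitness {a? = x ≟ x₂ r}) x∈r))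

endpoint∈ : ∀ (r : Request n) → x ≡ x₁ r ⊎ x ≡ x₂ r → x ∈ C → x ∈ C ∩ reqSet r
endpoint∈ r x∈r x∈C = x∈p∩q⁺ (x∈C , x∈⁅y⁆∪⁅z⁆⁺ x∈r)

migration : ∀ (r : Request n) → x ≡ x₁ r ⊎ x ≡ x₂ r → lookup C x ≡ true →
  ∃ λ c′ → c′ ∈ C ∩ reqSet r × (x , C ∩ reqSet r , suc (serveCost x r)) ≡ (c′ , C ∩ reqSet r , 2)
migration {x = x} {C = C} r x∈r x∈C =
  x , endpoint∈ r x∈r (lookup⇒[]= x C x∈C) , cong (λ k → x , C ∩ reqSet r , suc k) (serveCost-endpoint r x∈r)

moved≤migrations : ∀ (o : Fin n) ms → (if isEq (migrateAll o ms) o then 0 else 1) ≤ length ms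
moved≤migrations o [] with o ≟ o
... | yes _   = z≤n
... | no o≢o = contradiction refl o≢o
moved≤migrations o (m ∷ ms) with isEq (migrateAll m ms) o
... | true  = z≤n
... | false = s≤s z≤n

step-bound : ∀ s (r : Request n) o ms → Invariant s c C →
  2 * serveCost c r + Φ (shapeAfter C r) (lookup (nextCandidates C r) (migrateAll o ms))
    ≤ 3 * (length ms + serveCost (migrateAll o ms) r) + Φ s (lookup C o)
step-bound {c = c} {C = C} s r o ms inv = begin
    2 * serveCost c r + Φ (shapeAfter C r) (lookup (nextCandidates C r) o′)
  ≡⟨ cong (λ b → 2 * serveCost c r + Φ (shapeAfter C r) b) (lookup-nextCandidates C r o′) ⟩
    2 * serveCost c r + Φ (shapeAfter C r) (updated A B (lookup C o′) (isEq o′ (x₁ r) ∨ isEq o′ (x₂ r)))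
  ≤⟨ potential-step s A B _ _ _ _ _ _ _ same-membership same-membership same-membership
       (invariant-pinned s r inv) ⟩
    3 * ((if isEq o′ o then 0 else 1) + serveCost o′ r) + Φ s (lookup C o)
  ≤⟨ +-monoˡ-≤ _ (*-monoʳ-≤ 3 (+-monoˡ-≤ _ (moved≤migrations o ms))) ⟩
    3 * (length ms + serveCost o′ r) + Φ s (lookup C o)
  ∎
  where
  open ≤-Reasoning
  o′ = migrateAll o ms
  A = lookup C (x₁ r)
  B = lookup C (x₂ r)
  same-membership : ∀ {y} → T (isEq o′ y) → lookup C o′ ≡ lookup C y
  same-membership {y} = cong (lookup C) ∘ toWitness {a? = o′ ≟ y}

telescope : ∀ k R m R′ {P P′} → 2 * k + P′ ≤ 3 * m + P → 2 * R ≤ 3 * R′ + P′ →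
  2 * (k + R) ≤ 3 * (m + R′) + P
telescope k R m R′ {P} {P′} step rest = begin
    2 * (k + R)             ≡⟨ *-distribˡ-+ 2 k R ⟩
    2 * k + 2 * R           ≤⟨ +-monoʳ-≤ (2 * k) rest ⟩
    2 * k + (3 * R′ + P′)   ≡⟨ regroup₁ (2 * k) (3 * R′) P′ ⟩
    (2 * k + P′) + 3 * R′   ≤⟨ +-monoˡ-≤ (3 * R′) step ⟩
    (3 * m + P) + 3 * R′    ≡⟨ regroup₂ m R′ P ⟩
    3 * (m + R′) + P        ∎
  where
  open ≤-Reasoning
  regroup₁ : ∀ x y z → x + (y + z) ≡ (x + z) + y
  regroup₁ = solve-∀
  regroup₂ : ∀ x y z → (3 * x + z) + 3 * y ≡ 3 * (x + y) + z
  regroup₂ = solve-∀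

module _ (rank : Fin n → ℕ) where

  ptStep-spec : ∀ {c C} r → c ∈ C → ∃ λ c′ → c′ ∈ nextCandidates C r
    × ptStep rank c C r ≡ (c′ , nextCandidates C r , serveCost c r)
  ptStep-spec {c} {C} r c∈C
    with lookup C (x₁ r) in A | lookup C (x₂ r) in B | c ≟ x₁ r | c ≟ x₂ r
  ... | false | false | _         | _         = c , x∈p∪q⁺ (inj₁ c∈C) , refl
  ... | true  | _     | yes c≡x₁  | _         = c , endpoint∈ r (inj₁ c≡x₁) c∈C , refl
  ... | true  | true  | no _      | yes c≡x₂  = c , endpoint∈ r (inj₂ c≡x₂) c∈C , refl
  ... | false | true  | no _      | yes c≡x₂  = c , endpoint∈ r (inj₂ c≡x₂) c∈C , refl
  ... | true  | false | no _      | yes c≡x₂  = contradiction (subst (_∈ C) c≡x₂ c∈C) (lookup≡false⇒∉ B)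
  ... | false | true  | yes c≡x₁  | _         = contradiction (subst (_∈ C) c≡x₁ c∈C) (lookup≡false⇒∉ A)
  ... | true  | false | no _      | no _      = migration r (inj₁ refl) A
  ... | false | true  | no _      | no _      = migration r (inj₂ refl) B
  ... | true  | true  | no _      | no _      with rank (x₂ r) <ᵇ rank (x₁ r)
  ...   | true  = migration r (inj₂ refl) B
  ...   | false = migration r (inj₁ refl) A

  amortised-bound : ∀ s {c C} o σ (S : OfflineSchedule σ) → Invariant s c C →
    2 * ptRun rank c C σ ≤ 3 * offlineCost o σ S + Φ s (lookup C o)
  amortised-bound s o [] [] _ = z≤n
  amortised-bound s {c} {C} o (r ∷ σ) (ms ∷ S) inv@(c∈C , _)
    with ptStep rank c C r | ptStep-spec r c∈C
  ... | _ | c′ , c′∈ , refl =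
    telescope (serveCost c r) (ptRun rank c′ (nextCandidates C r) σ)
              (length ms + serveCost o′ r) (offlineCost o′ σ S)
      (step-bound s r o ms inv)
      (amortised-bound (shapeAfter C r) o′ σ S (c′∈ , nextCandidates-confined C r c′∈))
    where o′ = migrateAll o ms

-- Only the tie-breaking, never the bound, depends on rank.
theorem1 : (n : ℕ) (rank : Fin n → ℕ) → Injective _≡_ _≡_ rank →
    (xinit : Fin n) (σ : List (Request n)) (S : OfflineSchedule σ) →
    2 * ALG rank xinit σ ≤ 3 * offlineCost xinit σ S
theorem1 n rank _ xinit σ S = begin
    2 * ALG rank xinit σ
  ≤⟨ amortised-bound rank singleton xinit σ S (x∈⁅x⁆ xinit , id) ⟩
    3 * offlineCost xinit σ S + Φ singleton (lookup ⁅ xinit ⁆ xinit)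
  ≡⟨ cong (λ b → 3 * offlineCost xinit σ S + Φ singleton b) ([]=⇒lookup (x∈⁅x⁆ xinit)) ⟩
    3 * offlineCost xinit σ S + 0
  ≡⟨ +-identityʳ _ ⟩
    3 * offlineCost xinit σ S
  ∎
  where open ≤-Reasoning
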